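{- Let $\alpha\ge1$ and let OneEvent be an algorithm that, on any PSBA instance with a single event $e$, returns $t^*$ with $\sum_i\mathrm{agr}_i(\{(e,t^*)\})\ge\frac1\alpha\max_{t\in T}\sum_i\mathrm{agr}_i(\{(e,t)\})$. Let $\mathcal S$ be a partial event schedule and $e^*$ an event not scheduled in $\mathcal S$. For each agent $i$, let $F_i\subseteq\mathrm{st}(\mathcal S)$ be the set of agreement slots of some feasible job schedule of $J_i$ achieving $\mathrm{agr}_i(\mathcal S)$, and form a new agent $i'$ whose job set is $J_i$ together with rigid jobs whose job intervals are disjoint and together cover exactly $F_i$. Let $t^*$ be the output of OneEvent on the instance with agents $\{i'\}_{i\in A}$ and the single event $e^*$. Then $$\sum_{i\in A}\mathrm{agr}_i(\mathcal S\cup\{(e^*,t^*)\})\ \ge\ \frac1\alpha\max_{t\in T}\sum_{i\in A}\mathrm{agr}_i(\mathcal S\cup\{(e^*,t)\}).$$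
   Context: PSBA setting: discrete time slots $T=\{1,\dots,|T|\}$; event $e$ of length $l(e)$ scheduled at $t$ (pair $(e,t)$) occupies $\{t,\dots,t+l(e)-1\}$; a partial event schedule $\mathcal S$ is a set of such pairs with each event at most once, and $\mathrm{st}(\mathcal S)$ is the set of slots occupied by its events. Agent $i$ has job set $J_i$; job $j$ has release time $r_j$, deadline $d_j$, processing time $p_j\le d_j-r_j+1$; rigid means $p_j=d_j-r_j+1$ (a rigid job occupies its entire interval). A preemptive job schedule is feasible if each job gets $p_j$ distinct slots in its interval and each slot holds at most one job; each $J_i$ is feasible. Agreement slots of agent $i$: slots in $\mathrm{st}(\mathcal S)$ where no job of $J_i$ is processed; $\mathrm{agr}_i(\mathcal S)$ is the maximum number of agreement slots over feasible schedules of $J_i$.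
   Formalization: The approximation factor α of OneEvent is taken to be rational. -}

module Defs where

open import Data.Nat using (ℕ; zero; suc; _+_; _*_; _∸_; _≤_; _<_; _⊔_; _≤?_; _<?_; _≟_)
open import Data.Fin using (Fin; toℕ) renaming (_≟_ to _≟ᶠ_)
open import Data.Fin.Properties using (all?)
open import Data.Maybe using (Maybe; just; nothing)
import Data.Maybe.Properties as MaybeP
open import Data.Product using (_×_; _,_; proj₁; proj₂; ∃)
open import Data.Sum using (_⊎_)
open import Data.List using (List; []; _∷_; map; foldr; filter; length; lookup; concatMap; allFin)
open import Data.List.Relation.Unary.Any using (Any; any?)
open import Data.List.Relation.Unary.All using (All)
open import Data.List.Relation.Unary.Unique.Propositional using (Unique)
open import Data.List.Membership.Propositional using (_∈_)
open import Data.Vec using (Vec; []; _∷_; count) renaming (lookup to vlookup)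
open import Relation.Binary.PropositionalEquality using (_≡_)
open import Relation.Nullary using (¬_; Dec)
open import Relation.Nullary.Decidable using (_×-dec_; _→-dec_)
open import Function.Bundles using (_⇔_)

-- Time slots are the natural numbers 1 , … , n  (n = |T|).
-- Internally a slot is also given as  i : Fin n  standing for slot  suc (toℕ i).

slot : {n : ℕ} → Fin n → ℕ
slot i = suc (toℕ i)

-- Events and (partial) event schedules.
-- An occupied block is a pair (l , t): an event of length l started at t,
-- occupying slots t , … , t + l - 1.

Occupies : ℕ × ℕ → ℕ → Set
Occupies (l , t) s = t ≤ s × s < t + l

occupies? : (lt : ℕ × ℕ) (s : ℕ) → Dec (Occupies lt s)
occupies? (l , t) s = (t ≤? s) ×-dec (s <? t + l)

-- s ∈ st(S), where S is given by the list of its blocks (length , start)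
InSt : List (ℕ × ℕ) → ℕ → Set
InSt B s = Any (λ lt → Occupies lt s) B

inSt? : (B : List (ℕ × ℕ)) (s : ℕ) → Dec (InSt B s)
inSt? B s = any? (λ lt → occupies? lt s) B

ValidStart : ℕ → ℕ → ℕ → Set
ValidStart n l t = 1 ≤ t × t + l ≤ suc n

PartialEventSchedule : (n : ℕ) {k : ℕ} → (Fin k → ℕ) → List (Fin k × ℕ) → Set
PartialEventSchedule n len S =
  Unique (map proj₁ S) × All (λ et → ValidStart n (len (proj₁ et)) (proj₂ et)) S

blocks : {k : ℕ} → (Fin k → ℕ) → List (Fin k × ℕ) → List (ℕ × ℕ)
blocks len S = map (λ et → len (proj₁ et) , proj₂ et) S

record Job : Set where
  constructor job
  field
    r : ℕ
    d : ℕ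
    p : ℕ
open Job public

ValidJob : ℕ → Job → Set
ValidJob n j = 1 ≤ r j × r j ≤ d j × d j ≤ n × p j ≤ suc (d j) ∸ r j

Rigid : Job → Set
Rigid j = p j ≡ suc (d j) ∸ r j

InInterval : Job → ℕ → Set
InInterval j s = r j ≤ s × s ≤ d j

record Schedule (n : ℕ) (J : List Job) : Set where
  constructor sched
  field
    slots : Vec (Maybe (Fin (length J))) n
open Schedule public

slotsOf : {n : ℕ} {J : List Job} → Schedule n J → Fin (length J) → ℕ
slotsOf σ k = count (λ x → MaybeP.≡-dec _≟ᶠ_ x (just k)) (slots σ)

Feasible : (n : ℕ) (J : List Job) → Schedule n J → Set
Feasible n J σ =
  ∀ (k : Fin (length J)) →
    (∀ (i : Fin n) → vlookup (slots σ) i ≡ just k → InInterval (lookup J k) (slot i))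
    × slotsOf σ k ≡ p (lookup J k)

feasible? : (n : ℕ) (J : List Job) (σ : Schedule n J) → Dec (Feasible n J σ)
feasible? n J σ = all? λ k →
  all? (λ i → MaybeP.≡-dec _≟ᶠ_ (vlookup (slots σ) i) (just k)
               →-dec ((r (lookup J k) ≤? slot i) ×-dec (slot i ≤? d (lookup J k))))
  ×-dec (slotsOf σ k ≟ p (lookup J k))

JobSetFeasible : ℕ → List Job → Set
JobSetFeasible n J = ∃ λ (σ : Schedule n J) → Feasible n J σ

AgreementSlot : {n : ℕ} {J : List Job} → List (ℕ × ℕ) → Schedule n J → Fin n → Set
AgreementSlot B σ i = InSt B (slot i) × vlookup (slots σ) i ≡ nothing

agreementSlot? : {n : ℕ} {J : List Job} (B : List (ℕ × ℕ)) (σ : Schedule n J) (i : Fin n) →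
                 Dec (AgreementSlot B σ i)
agreementSlot? B σ i = inSt? B (slot i) ×-dec MaybeP.≡-dec _≟ᶠ_ (vlookup (slots σ) i) nothing

agreeCount : {n : ℕ} {J : List Job} → List (ℕ × ℕ) → Schedule n J → ℕ
agreeCount {n} B σ = count (λ i → agreementSlot? B σ i) (Data.Vec.allFin n)
  where import Data.Vec

allVecs : {A : Set} → List A → (n : ℕ) → List (Vec A n)
allVecs xs zero    = [] ∷ []
allVecs xs (suc n) = concatMap (λ v → map (λ x → x ∷ v) xs) (allVecs xs n)

allSchedules : (n : ℕ) (J : List Job) → List (Schedule n J)
allSchedules n J = map sched (allVecs (nothing ∷ map just (allFin (length J))) n)

maxList : List ℕ → ℕ
maxList = foldr _⊔_ 0

agr : (n : ℕ) (J : List Job) → List (ℕ × ℕ) → ℕ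
agr n J B = maxList (map (agreeCount B) (filter (feasible? n J) (allSchedules n J)))

sumFin : (a : ℕ) → (Fin a → ℕ) → ℕ
sumFin zero    f = 0
sumFin (suc a) f = f Fin.zero + sumFin a (λ i → f (Fin.suc i))
  where import Data.Fin as Fin

RigidCover : (n : ℕ) → (Fin n → Set) → List Job → Set
RigidCover n F R =
  All (λ j → ValidJob n j × Rigid j) R
  × (∀ (k k′ : Fin (length R)) → ¬ (k ≡ k′) →
       d (lookup R k) < r (lookup R k′) ⊎ d (lookup R k′) < r (lookup R k))
  × (∀ (i : Fin n) → Any (λ j → InInterval j (slot i)) R ⇔ F i)

-- OneEvent: an algorithm taking  n = |T|, agents  J : Fin a → List Job  and the
-- length l of the single event, returning a start time.

OneEventAlg : Set
OneEventAlg = (n a : ℕ) → (Fin a → List Job) → ℕ → ℕ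

-- α-approximation with α = α₁ / α₂ (so "≥ (1/α) · max" reads α₂ · max ≤ α₁ · value)
IsApprox : ℕ → ℕ → OneEventAlg → Set
IsApprox α₁ α₂ alg =
  ∀ (n a : ℕ) (J : Fin a → List Job) (l : ℕ) →
    (∀ i → All (ValidJob n) (J i)) → (∀ i → JobSetFeasible n (J i)) → l ≤ n →
    ValidStart n l (alg n a J l)
    × (∀ t → ValidStart n l t →
         α₂ * sumFin a (λ i → agr n (J i) ((l , t) ∷ []))
           ≤ α₁ * sumFin a (λ i → agr n (J i) ((l , alg n a J l) ∷ [])))

{-# OPTIONS --safe #-}
module Submission where

-- Fix an agent, an optimal schedule σ of J for S with agreement slots F, and let b be the
-- block of e* started at t. The key identity is
--   agr_i(S ∪ {(e*,t)}) = agr_i(S) + agr_i'({(e*,t)}).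
-- ≥: restricting an optimal schedule τ of J ++ R to J frees F (occupied in τ by the rigid
-- jobs) and the agreement slots of τ on b, which are disjoint from F.
-- ≤: an augmenting-path exchange against σ makes any feasible schedule of J idle on all of F
-- without losing agreement slots; its agreement slots on b outside st(S) then stay idle
-- when the rigid jobs are added.
-- Summing over the agents, agr_i(S) does not depend on t, so the guarantee of OneEvent on
-- the agents i' carries over, using α ≥ 1 for the first summand.

open import Defs
open import Level using (0ℓ)
open import Function.Base using (_∘_; id)
open import Function.Bundles using (Equivalence)
open import Induction.WellFounded using (Acc; acc)
open import Data.Bool.Base using (if_then_else_)
open import Data.Nat using (ℕ; zero; suc; _+_; _*_; _∸_; _≤_; _<_; _≤?_; z≤n; s≤s)
open import Data.Nat.Properties
open import Algebra.Properties.CommutativeSemigroup +-commutativeSemigroup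
  using (interchange; xy∙z≈zy∙x)
open import Data.Nat.Induction using (<-wellFounded)
open import Data.Fin using (Fin; zero; suc)
open import Data.Fin.Properties using (any?)
  renaming (_≟_ to _≟ᶠ_; suc-injective to fin-suc-injective)
open import Data.Maybe using (Maybe; just; nothing; _>>=_)
open import Data.Maybe.Properties using (just-injective) renaming (≡-dec to ≡-dec-Maybe)
open import Data.Product using (_×_; _,_; proj₁; proj₂; ∃; ∃₂; uncurry)
open import Data.Sum using (_⊎_; inj₁; inj₂; [_,_]′; map₁; isInj₁)
open import Data.Sum.Properties using (inj₁-injective; inj₂-injective)
open import Data.List using (List; []; _∷_; _++_; map; filter; length)
  renaming (allFin to allFinₗ; lookup to lookupₗ)
open import Data.List.Relation.Unary.All using (All)
import Data.List.Relation.Unary.All as All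
open import Data.List.Relation.Unary.All.Properties using (++⁺)
open import Data.List.Relation.Unary.Any as Any using (Any)
  renaming (here to hereₗ; there to thereₗ)
open import Data.List.Relation.Unary.Any.Properties using (lookup-index)
open import Data.List.Membership.Propositional using (_∈_; _∉_; lose)
open import Data.List.Membership.Propositional.Properties
  using (∈-map⁺; ∈-map⁻; ∈-filter⁺; ∈-filter⁻; ∈-concatMap⁺; ∈-allFin; ∈-lookup)
open import Data.Vec using (Vec; []; _∷_; count; tabulate; allFin; lookup; _[_]≔_)
  renaming (map to mapᵥ)
open import Data.Vec.Properties
  using (tabulate-allFin; tabulate∘lookup; allFin-map; lookup∘update; lookup∘update′; lookup∘tabulate)
open import Data.Vec.Relation.Unary.Any using (here; there)
open import Data.Vec.Membership.Propositional using () renaming (_∈_ to _∈ᵥ_)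
open import Data.Vec.Membership.Propositional.Properties using (∈-allFin⁺)
open import Relation.Nullary using (Dec; yes; no; does; ¬_; contradiction)
open import Relation.Nullary.Decidable using (_×-dec_; ¬?; decidable-stable)
open import Relation.Unary using (Pred; Decidable; _⊆_; _∪_; _∩_; _⊥_; ∁)
open import Relation.Unary.Properties using (_∪?_; _∩?_; ∁?)
open import Relation.Binary.PropositionalEquality

private
  variable
    X Y : Set
    n : ℕ
    P Q : Pred X 0ℓ

indicator : {X : Set} → Dec X → ℕ
indicator (yes _) = 1
indicator (no _)  = 0

indicator-yes : {X : Set} (X? : Dec X) → X → indicator X? ≡ 1
indicator-yes (yes _) _ = refl
indicator-yes (no ¬x) x = contradiction x ¬x

indicator-no : {X : Set} (X? : Dec X) → ¬ X → indicator X? ≡ 0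
indicator-no (yes x) ¬x = contradiction x ¬x
indicator-no (no _)  _  = refl

count-∷ : (P? : Decidable P) (x : X) (xs : Vec X n) →
          count P? (x ∷ xs) ≡ indicator (P? x) + count P? xs
count-∷ P? x xs with P? x
... | yes _ = refl
... | no _  = refl

count-map : (P? : Decidable P) (f : Y → X) (xs : Vec Y n) →
            count P? (mapᵥ f xs) ≡ count (P? ∘ f) xs
count-map P? f []       = refl
count-map P? f (x ∷ xs) = cong (if does (P? (f x)) then suc else id) (count-map P? f xs)

count-tabulate : (P? : Decidable P) (f : Fin n → X) →
                 count P? (tabulate f) ≡ count (P? ∘ f) (allFin n)
count-tabulate P? f = trans (cong (count P?) (tabulate-allFin f)) (count-map P? f (allFin _))

count-lookup : (P? : Decidable P) (xs : Vec X n) →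
               count P? xs ≡ count (P? ∘ lookup xs) (allFin n)
count-lookup P? xs =
  trans (cong (count P?) (sym (tabulate∘lookup xs))) (count-tabulate P? (lookup xs))

count-allFin-suc : (P? : Decidable P) →
                   count P? (allFin (suc n)) ≡ indicator (P? zero) + count (P? ∘ suc) (allFin n)
count-allFin-suc {n = n} P? = begin
  count P? (allFin (suc n))                               ≡⟨ cong (count P?) (allFin-map n) ⟩
  count P? (zero ∷ mapᵥ suc (allFin n))                   ≡⟨ count-∷ P? zero (mapᵥ suc (allFin n)) ⟩
  indicator (P? zero) + count P? (mapᵥ suc (allFin n))    ≡⟨ cong (indicator (P? zero) +_)
                                                                   (count-map P? suc (allFin n)) ⟩
  indicator (P? zero) + count (P? ∘ suc) (allFin n)       ∎
  where open ≡-Reasoning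

count-none : (P? : Decidable P) → (∀ x → ¬ P x) → (xs : Vec X n) → count P? xs ≡ 0
count-none P? none []       = refl
count-none P? none (x ∷ xs) with P? x
... | yes px = contradiction px (none x)
... | no _   = count-none P? none xs

count-mono : (P? : Decidable P) (Q? : Decidable Q) → P ⊆ Q →
             (xs : Vec X n) → count P? xs ≤ count Q? xs
count-mono P? Q? P⊆Q []       = z≤n
count-mono P? Q? P⊆Q (x ∷ xs) with P? x | Q? x
... | yes _  | yes _  = s≤s (count-mono P? Q? P⊆Q xs)
... | yes px | no ¬qx = contradiction (P⊆Q px) ¬qx
... | no _   | yes _  = m≤n⇒m≤1+n (count-mono P? Q? P⊆Q xs)
... | no _   | no _   = count-mono P? Q? P⊆Q xs

count-cong : (P? : Decidable P) (Q? : Decidable Q) → P ⊆ Q → Q ⊆ P →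
             (xs : Vec X n) → count P? xs ≡ count Q? xs
count-cong P? Q? P⊆Q Q⊆P xs = ≤-antisym (count-mono P? Q? P⊆Q xs) (count-mono Q? P? Q⊆P xs)

count-< : (P? : Decidable P) (Q? : Decidable Q) → Q ⊆ P →
          ∀ {x} → P x → ¬ Q x → {xs : Vec X n} → x ∈ᵥ xs → count Q? xs < count P? xs
count-< P? Q? Q⊆P px ¬qx {y ∷ xs} (here refl) with P? y | Q? y
... | _      | yes qy = contradiction qy ¬qx
... | no ¬py | no _   = contradiction px ¬py
... | yes _  | no _   = s≤s (count-mono Q? P? Q⊆P xs)
count-< P? Q? Q⊆P px ¬qx {y ∷ xs} (there x∈xs) with P? y | Q? y
... | yes _  | yes _  = s≤s (count-< P? Q? Q⊆P px ¬qx x∈xs)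
... | no ¬py | yes qy = contradiction (Q⊆P qy) ¬py
... | yes _  | no _   = m≤n⇒m≤1+n (count-< P? Q? Q⊆P px ¬qx x∈xs)
... | no _   | no _   = count-< P? Q? Q⊆P px ¬qx x∈xs

count-∪-∩ : (P? : Decidable P) (Q? : Decidable Q) (xs : Vec X n) →
            count (P? ∪? Q?) xs + count (P? ∩? Q?) xs ≡ count P? xs + count Q? xs
count-∪-∩ P? Q? []       = refl
count-∪-∩ P? Q? (x ∷ xs) with P? x | Q? x | count-∪-∩ P? Q? xs
... | yes _ | yes _ | eq = cong suc (trans (+-suc _ _) (trans (cong suc eq) (sym (+-suc _ _))))
... | yes _ | no _  | eq = cong suc eq
... | no _  | yes _ | eq = trans (cong suc eq) (sym (+-suc _ _))
... | no _  | no _  | eq = eq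

count-⊆-∪ : (P? : Decidable P) (Q? : Decidable Q) {R : Pred X 0ℓ} (R? : Decidable R) →
            R ⊆ P ∪ Q → (xs : Vec X n) → count R? xs ≤ count P? xs + count Q? xs
count-⊆-∪ P? Q? R? R⊆P∪Q xs = begin
  count R? xs                                  ≤⟨ count-mono R? (P? ∪? Q?) R⊆P∪Q xs ⟩
  count (P? ∪? Q?) xs                          ≤⟨ m≤m+n _ _ ⟩
  count (P? ∪? Q?) xs + count (P? ∩? Q?) xs    ≡⟨ count-∪-∩ P? Q? xs ⟩
  count P? xs + count Q? xs                    ∎
  where open ≤-Reasoning

count-disjoint-⊆ : (P? : Decidable P) (Q? : Decidable Q) {R : Pred X 0ℓ} (R? : Decidable R) →
                   P ⊥ Q → P ∪ Q ⊆ R → (xs : Vec X n) → count P? xs + count Q? xs ≤ count R? xs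
count-disjoint-⊆ P? Q? R? P⊥Q P∪Q⊆R xs = begin
  count P? xs + count Q? xs                    ≡⟨ count-∪-∩ P? Q? xs ⟨
  count (P? ∪? Q?) xs + count (P? ∩? Q?) xs    ≡⟨ cong (count (P? ∪? Q?) xs +_)
                                                       (count-none (P? ∩? Q?) (λ _ → P⊥Q) xs) ⟩
  count (P? ∪? Q?) xs + 0                      ≡⟨ +-identityʳ _ ⟩
  count (P? ∪? Q?) xs                          ≤⟨ count-mono (P? ∪? Q?) R? P∪Q⊆R xs ⟩
  count R? xs                                  ∎
  where open ≤-Reasoning

count-update : (P? : Decidable P) (xs : Vec X n) (i : Fin n) (y : X) →
               count P? (xs [ i ]≔ y) + indicator (P? (lookup xs i)) ≡ count P? xs + indicator (P? y)
count-update P? (x ∷ xs) zero y = begin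
  count P? (y ∷ xs) + indicator (P? x)                 ≡⟨ cong (_+ indicator (P? x)) (count-∷ P? y xs) ⟩
  indicator (P? y) + count P? xs + indicator (P? x)    ≡⟨ xy∙z≈zy∙x (indicator (P? y)) _ _ ⟩
  indicator (P? x) + count P? xs + indicator (P? y)    ≡⟨ cong (_+ indicator (P? y)) (count-∷ P? x xs) ⟨
  count P? (x ∷ xs) + indicator (P? y)                 ∎
  where open ≡-Reasoning
count-update P? (x ∷ xs) (suc i) y = begin
  count P? (x ∷ xs [ i ]≔ y) + indicator (P? (lookup xs i))
    ≡⟨ cong (_+ indicator (P? (lookup xs i))) (count-∷ P? x (xs [ i ]≔ y)) ⟩
  indicator (P? x) + count P? (xs [ i ]≔ y) + indicator (P? (lookup xs i))
    ≡⟨ +-assoc (indicator (P? x)) _ _ ⟩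
  indicator (P? x) + (count P? (xs [ i ]≔ y) + indicator (P? (lookup xs i)))
    ≡⟨ cong (indicator (P? x) +_) (count-update P? xs i y) ⟩
  indicator (P? x) + (count P? xs + indicator (P? y))
    ≡⟨ +-assoc (indicator (P? x)) _ _ ⟨
  indicator (P? x) + count P? xs + indicator (P? y)
    ≡⟨ cong (_+ indicator (P? y)) (count-∷ P? x xs) ⟨
  count P? (x ∷ xs) + indicator (P? y)
    ∎
  where open ≡-Reasoning

count-<-witness : (P? : Decidable P) (xs ys : Vec X n) → count P? xs < count P? ys →
                  ∃ λ i → P (lookup ys i) × ¬ P (lookup xs i)
count-<-witness P? (x ∷ xs) (y ∷ ys) lt with P? x | P? y
... | no ¬px | yes py = zero , py , ¬px
... | yes _  | yes _  = let i , pyi , ¬pxi = count-<-witness P? xs ys (≤-pred lt) in suc i , pyi , ¬pxi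
... | no _   | no _   = let i , pyi , ¬pxi = count-<-witness P? xs ys lt         in suc i , pyi , ¬pxi
... | yes _  | no _   = let i , pyi , ¬pxi = count-<-witness P? xs ys (<⇒≤ lt)   in suc i , pyi , ¬pxi

count-≟-allFin : (y : Fin n) → count (_≟ᶠ y) (allFin n) ≤ 1
count-≟-allFin {suc n} zero = ≤-reflexive (begin
  count (_≟ᶠ zero) (allFin (suc n))                ≡⟨ count-allFin-suc {n = n} (_≟ᶠ zero) ⟩
  1 + count (λ x → suc x ≟ᶠ zero) (allFin n)       ≡⟨ cong suc (count-none _ (λ _ ()) (allFin n)) ⟩
  1                                                ∎)
  where open ≡-Reasoning
count-≟-allFin {suc n} (suc y) = begin
  count (_≟ᶠ suc y) (allFin (suc n))               ≡⟨ count-allFin-suc {n = n} (_≟ᶠ suc y) ⟩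
  count (λ x → suc x ≟ᶠ suc y) (allFin n)          ≡⟨ count-cong _ (_≟ᶠ y) fin-suc-injective (cong suc)
                                                                 (allFin n) ⟩
  count (_≟ᶠ y) (allFin n)                         ≤⟨ count-≟-allFin y ⟩
  1                                                ∎
  where open ≤-Reasoning

inInterval? : (j : Job) (s : ℕ) → Dec (InInterval j s)
inInterval? j s = (r j ≤? s) ×-dec (s ≤? d j)

module _ (j : Job) where

  private
    window : (n c : ℕ) → ℕ
    window n c = count (λ (x : Fin n) → inInterval? j (c + slot x)) (allFin n)

    window-suc : ∀ n c → window (suc n) c ≡ indicator (inInterval? j (suc c)) + window n (suc c)
    window-suc n c = trans (count-allFin-suc {n = n} (λ x → inInterval? j (c + slot x)))
      (cong₂ _+_ (cong (indicator ∘ inInterval? j) (+-comm c 1))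
                 (count-cong (λ x → inInterval? j (c + suc (slot x)))
                             (λ x → inInterval? j (suc c + slot x))
                             (subst (InInterval j) (+-suc c _))
                             (subst (InInterval j) (sym (+-suc c _)))
                             (allFin n)))

    window-inside : ∀ {n c} → r j ≤ suc c → d j ≤ c + n → window n c ≡ d j ∸ c
    window-inside {zero} {c} _ d≤c+0 = sym (m≤n⇒m∸n≡0 (subst (d j ≤_) (+-identityʳ c) d≤c+0))
    window-inside {suc n} {c} r≤c+1 d≤c+n+1 with suc c ≤? d j
    ... | yes c<d = begin
      window (suc n) c                                       ≡⟨ window-suc n c ⟩
      indicator (inInterval? j (suc c)) + window n (suc c)
        ≡⟨ cong₂ _+_ (indicator-yes _ (r≤c+1 , c<d)) rest ⟩
      1 + (d j ∸ suc c)                                      ≡⟨ +-∸-assoc 1 c<d ⟨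
      d j ∸ c                                                ∎
      where
      open ≡-Reasoning

      rest : window n (suc c) ≡ d j ∸ suc c
      rest = window-inside (m≤n⇒m≤1+n r≤c+1) (subst (d j ≤_) (+-suc c n) d≤c+n+1)
    ... | no c≮d = begin
      window (suc n) c                                       ≡⟨ window-suc n c ⟩
      indicator (inInterval? j (suc c)) + window n (suc c)
        ≡⟨ cong₂ _+_ (indicator-no _ (c≮d ∘ proj₂)) rest ⟩
      d j ∸ suc c                                            ≡⟨ m≤n⇒m∸n≡0 (m≤n⇒m≤1+n d≤c) ⟩
      0                                                      ≡⟨ m≤n⇒m∸n≡0 d≤c ⟨
      d j ∸ c                                                ∎
      where
      open ≡-Reasoning

      d≤c : d j ≤ c
      d≤c = ≮⇒≥ c≮d

      rest : window n (suc c) ≡ d j ∸ suc c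
      rest = window-inside (m≤n⇒m≤1+n r≤c+1) (subst (d j ≤_) (+-suc c n) d≤c+n+1)

    window-before : ∀ {n c} → c < r j → d j ≤ c + n → window n c ≡ suc (d j) ∸ r j
    window-before {n} {c} c<r d≤c+n with suc c ≟ r j
    ... | yes refl = window-inside ≤-refl d≤c+n
    window-before {zero} {c} c<r d≤c+0 | no _ =
      sym (m≤n⇒m∸n≡0 (≤-trans (s≤s (subst (d j ≤_) (+-identityʳ c) d≤c+0)) c<r))
    window-before {suc n} {c} c<r d≤c+n+1 | no c+1≢r = begin
      window (suc n) c                                       ≡⟨ window-suc n c ⟩
      indicator (inInterval? j (suc c)) + window n (suc c)
        ≡⟨ cong (_+ window n (suc c)) (indicator-no _ before) ⟩
      window n (suc c)
        ≡⟨ window-before (≤∧≢⇒< c<r c+1≢r) (subst (d j ≤_) (+-suc c n) d≤c+n+1) ⟩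
      suc (d j) ∸ r j                                        ∎
      where
      open ≡-Reasoning

      before : ¬ InInterval j (suc c)
      before (r≤c+1 , _) = c+1≢r (≤-antisym c<r r≤c+1)

  interval-count : 1 ≤ r j → d j ≤ n →
                   count (λ (x : Fin n) → inInterval? j (slot x)) (allFin n) ≡ suc (d j) ∸ r j
  interval-count = window-before

  rigid-count : ValidJob n j → Rigid j → count (λ (x : Fin n) → inInterval? j (slot x)) (allFin n) ≡ p j
  rigid-count (1≤r , _ , d≤n , _) rigid = trans (interval-count 1≤r d≤n) (sym rigid)

maxList-upper : ∀ {x xs} → x ∈ xs → x ≤ maxList xs
maxList-upper {xs = y ∷ xs} (hereₗ refl)  = m≤m⊔n y (maxList xs)
maxList-upper {xs = y ∷ xs} (thereₗ x∈xs) = ≤-trans (maxList-upper x∈xs) (m≤n⊔m y (maxList xs))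

maxList-∈ : ∀ {x xs} → x ∈ xs → maxList xs ∈ xs
maxList-∈ {xs = y ∷ []}     _ = hereₗ (⊔-identityʳ y)
maxList-∈ {xs = y ∷ z ∷ xs} _ =
  [ hereₗ , (λ max≡m → thereₗ (Any.map (trans max≡m) (maxList-∈ (hereₗ {xs = xs} refl)))) ]′
    (⊔-sel y (maxList (z ∷ xs)))

allVecs-complete : {xs : List X} → (∀ x → x ∈ xs) → (v : Vec X n) → v ∈ allVecs xs n
allVecs-complete all-in []      = hereₗ refl
allVecs-complete all-in (x ∷ v) =
  ∈-concatMap⁺ (λ w → map (_∷ w) _) (Any.map (λ { refl → ∈-map⁺ (_∷ _) (all-in x) })
                                             (allVecs-complete all-in v))

∈-allSchedules : {J : List Job} (σ : Schedule n J) → σ ∈ allSchedules n J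
∈-allSchedules (sched v) = ∈-map⁺ sched (allVecs-complete every-entry v)
  where
  every-entry : ∀ x → x ∈ nothing ∷ map just (allFinₗ _)
  every-entry nothing  = hereₗ refl
  every-entry (just k) = thereₗ (∈-map⁺ just (∈-allFin k))

∈-feasibleSchedules : {J : List Job} {σ : Schedule n J} → Feasible n J σ →
                      σ ∈ filter (feasible? n J) (allSchedules n J)
∈-feasibleSchedules {n} {J} {σ} σ-feasible = ∈-filter⁺ (feasible? n J) (∈-allSchedules σ) σ-feasible

module _ {n : ℕ} {J : List Job} (B : List (ℕ × ℕ)) where

  agreeCount≤agr : {σ : Schedule n J} → Feasible n J σ → agreeCount B σ ≤ agr n J B
  agreeCount≤agr {σ} σ-feasible =
    maxList-upper (∈-map⁺ (agreeCount B) (∈-feasibleSchedules {σ = σ} σ-feasible))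

  agr-attained : JobSetFeasible n J → ∃ λ τ → Feasible n J τ × agr n J B ≡ agreeCount B τ
  agr-attained (σ , σ-feasible) =
    let τ , τ∈feasible , agr≡ = ∈-map⁻ (agreeCount B) (maxList-∈ (∈-map⁺ (agreeCount B)
                                  (∈-feasibleSchedules {σ = σ} σ-feasible)))
    in  τ , proj₂ (∈-filter⁻ (feasible? n J) {xs = allSchedules n J} τ∈feasible) , agr≡

_≟ₘ_ : {m : ℕ} (x y : Maybe (Fin m)) → Dec (x ≡ y)
_≟ₘ_ = ≡-dec-Maybe _≟ᶠ_

module _ {n : ℕ} {J : List Job} where

  jobAt : Schedule n J → Fin n → Maybe (Fin (length J))
  jobAt σ = lookup (slots σ)

  Idle : Schedule n J → Pred (Fin n) 0ℓ
  Idle σ x = jobAt σ x ≡ nothing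

  idle? : (σ : Schedule n J) → Decidable (Idle σ)
  idle? σ x = jobAt σ x ≟ₘ nothing

  WithinIntervals : Schedule n J → Set
  WithinIntervals σ = ∀ k x → jobAt σ x ≡ just k → InInterval (lookupₗ J k) (slot x)

  Lacks : Maybe (Fin (length J)) → Schedule n J → Set
  Lacks m σ = ∀ k → slotsOf σ k + indicator (m ≟ₘ just k) ≡ p (lookupₗ J k)

  feasible⇒within : {σ : Schedule n J} → Feasible n J σ → WithinIntervals σ
  feasible⇒within σ-feasible k = proj₁ (σ-feasible k)

  feasible⇒lacks : {σ : Schedule n J} → Feasible n J σ → Lacks nothing σ
  feasible⇒lacks σ-feasible k = trans (+-identityʳ _) (proj₂ (σ-feasible k))

  within∧lacks⇒feasible : {σ : Schedule n J} → WithinIntervals σ → Lacks nothing σ → Feasible n J σ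
  within∧lacks⇒feasible within lacks k = within k , trans (sym (+-identityʳ _)) (lacks k)

  slotsOf≡count : (σ : Schedule n J) (k : Fin (length J)) →
                  slotsOf σ k ≡ count (λ x → jobAt σ x ≟ₘ just k) (allFin n)
  slotsOf≡count σ k = count-lookup (_≟ₘ just k) (slots σ)

  lacks-short : {v σ : Schedule n J} {j : Fin (length J)} → Lacks (just j) v → Lacks nothing σ →
                slotsOf v j < slotsOf σ j
  lacks-short {v} {σ} {j} v-lacks σ-lacks = ≤-reflexive (begin
    suc (slotsOf v j)                             ≡⟨ +-comm 1 (slotsOf v j) ⟩
    slotsOf v j + 1                               ≡⟨ cong (slotsOf v j +_) (indicator-yes _ refl) ⟨
    slotsOf v j + indicator (just j ≟ₘ just j)    ≡⟨ v-lacks j ⟩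
    p (lookupₗ J j)                               ≡⟨ σ-lacks j ⟨
    slotsOf σ j + 0                               ≡⟨ +-identityʳ (slotsOf σ j) ⟩
    slotsOf σ j                                   ∎)
    where open ≡-Reasoning

  rigid-fills : {τ : Schedule n J} {k : Fin (length J)} → Feasible n J τ →
                ValidJob n (lookupₗ J k) → Rigid (lookupₗ J k) →
                ∀ {x} → InInterval (lookupₗ J k) (slot x) → jobAt τ x ≡ just k
  rigid-fills {τ} {k} τ-feasible valid rigid {x} inside with jobAt τ x ≟ₘ just k
  ... | yes runs = runs
  ... | no idles = contradiction
    (count-< (λ x → inInterval? (lookupₗ J k) (slot x)) (λ x → jobAt τ x ≟ₘ just k)
             (λ {x} → feasible⇒within {σ = τ} τ-feasible k x) inside idles (∈-allFin⁺ x))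
    (<-irrefl (sym (begin
      count (λ x → inInterval? (lookupₗ J k) (slot x)) (allFin n)  ≡⟨ rigid-count _ valid rigid ⟩
      p (lookupₗ J k)                                               ≡⟨ proj₂ (τ-feasible k) ⟨
      slotsOf τ k                                                   ≡⟨ slotsOf≡count τ k ⟩
      count (λ x → jobAt τ x ≟ₘ just k) (allFin n)                  ∎)))
    where open ≡-Reasoning

  assign : Schedule n J → Fin n → Maybe (Fin (length J)) → Schedule n J
  assign σ x m = sched (slots σ [ x ]≔ m)

  jobAt-assign : (σ : Schedule n J) (x : Fin n) (m : Maybe (Fin (length J))) →
                 jobAt (assign σ x m) x ≡ m
  jobAt-assign σ x m = lookup∘update x (slots σ) m

  jobAt-assign-≢ : (σ : Schedule n J) {x y : Fin n} (m : Maybe (Fin (length J))) →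
                   y ≢ x → jobAt (assign σ x m) y ≡ jobAt σ y
  jobAt-assign-≢ σ m y≢x = lookup∘update′ y≢x (slots σ) m

  assign-within : {σ : Schedule n J} {x : Fin n} {m : Maybe (Fin (length J))} → WithinIntervals σ →
                  (∀ k → m ≡ just k → InInterval (lookupₗ J k) (slot x)) →
                  WithinIntervals (assign σ x m)
  assign-within {σ} {x} {m} within m-within k y runs with y ≟ᶠ x
  ... | yes refl = m-within k (trans (sym (jobAt-assign σ x m)) runs)
  ... | no y≢x   = within k y (trans (sym (jobAt-assign-≢ σ m y≢x)) runs)

  assign-lacks : {σ : Schedule n J} {m : Maybe (Fin (length J))} (x : Fin n) →
                 Lacks m σ → Lacks (jobAt σ x) (assign σ x m)
  assign-lacks {σ} {m} x lacks k = trans (count-update (_≟ₘ just k) (slots σ) x m) (lacks k)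

-- The exchange argument

module _ {n : ℕ} {J : List Job} {σ : Schedule n J} (σ-feasible : Feasible n J σ) where

  Exchange : Schedule n J → Fin n → Set
  Exchange ρ f = ∃₂ λ (ρ′ : Schedule n J) (y : Fin n) →
    Feasible n J ρ′ × Idle ρ′ f × ¬ Idle σ y × (∀ {x} → x ≢ y → Idle ρ x → Idle ρ′ x)

  private
    disagreement : Schedule n J → ℕ
    disagreement v = count (λ x → ¬? (jobAt v x ≟ₘ jobAt σ x)) (allFin n)

    record Augmenting (ρ : Schedule n J) (f : Fin n) (v : Schedule n J) (j : Fin (length J)) : Set where
      field
        within : WithinIntervals v
        lacks  : Lacks (just j) v
        idle-f : Idle v f
        keeps  : Idle ρ ⊆ Idle v

    -- σ runs j on some slot s where v does not. Giving s to j either ends the path at an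
    -- idle slot or leaves the job displaced from s one slot short; either way v now agrees
    -- with σ at one more slot.
    augment : ∀ {ρ f v j} → Idle σ f → Augmenting ρ f v j → Acc _<_ (disagreement v) → Exchange ρ f
    augment {ρ} {f} {v} {j} σf state (acc more) = continue (jobAt v s) refl
      where
      open Augmenting state

      witness : ∃ λ (s : Fin n) → jobAt σ s ≡ just j × jobAt v s ≢ just j
      witness = count-<-witness (_≟ₘ just j) (slots v) (slots σ)
                                (lacks-short {v = v} {σ} lacks (feasible⇒lacks {σ = σ} σ-feasible))

      s : Fin n
      s = proj₁ witness

      σs≡j : jobAt σ s ≡ just j
      σs≡j = proj₁ (proj₂ witness)

      σs-busy : ¬ Idle σ s
      σs-busy σs-idle with trans (sym σs≡j) σs-idle
      ... | ()

      v′ : Schedule n J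
      v′ = assign v s (just j)

      v′s≡σs : jobAt v′ s ≡ jobAt σ s
      v′s≡σs = trans (jobAt-assign v s (just j)) (sym σs≡j)

      v′-within : WithinIntervals v′
      v′-within = assign-within {σ = v} within λ k j≡k →
        subst (λ k → InInterval (lookupₗ J k) (slot s)) (just-injective j≡k)
              (feasible⇒within {σ = σ} σ-feasible j s σs≡j)

      v′-idle-f : Idle v′ f
      v′-idle-f = trans (jobAt-assign-≢ v (just j) λ f≡s → σs-busy (subst (Idle σ) f≡s σf)) idle-f

      keeps-off-s : ∀ {x} → x ≢ s → Idle ρ x → Idle v′ x
      keeps-off-s x≢s ρx = trans (jobAt-assign-≢ v (just j) x≢s) (keeps ρx)

      fewer : disagreement v′ < disagreement v
      fewer = count-< (λ x → ¬? (jobAt v x ≟ₘ jobAt σ x)) (λ x → ¬? (jobAt v′ x ≟ₘ jobAt σ x))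
                      still-disagrees (λ vs≡σs → proj₂ (proj₂ witness) (trans vs≡σs σs≡j))
                      (λ v′s≢σs → v′s≢σs v′s≡σs) (∈-allFin⁺ s)
        where
        still-disagrees : ∀ {x} → jobAt v′ x ≢ jobAt σ x → jobAt v x ≢ jobAt σ x
        still-disagrees {x} v′x≢σx vx≡σx with x ≟ᶠ s
        ... | yes refl = v′x≢σx v′s≡σs
        ... | no x≢s   = v′x≢σx (trans (jobAt-assign-≢ v (just j) x≢s) vx≡σx)

      continue : ∀ m → jobAt v s ≡ m → Exchange ρ f
      continue nothing vs-idle =
        v′ , s , feasible , v′-idle-f , σs-busy , keeps-off-s
        where
        feasible : Feasible n J v′
        feasible = within∧lacks⇒feasible {σ = v′} v′-within
                     (subst (λ m → Lacks m v′) vs-idle (assign-lacks {σ = v} s lacks))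
      continue (just j′) vs≡j′ = augment σf next (more fewer)
        where
        keeps′ : Idle ρ ⊆ Idle v′
        keeps′ {x} ρx with x ≟ᶠ s
        ... | yes refl with trans (sym vs≡j′) (keeps ρx)
        ...   | ()
        keeps′ {x} ρx | no x≢s = keeps-off-s x≢s ρx

        next : Augmenting ρ f v′ j′
        next = record { within = v′-within
                      ; lacks  = subst (λ m → Lacks m v′) vs≡j′ (assign-lacks {σ = v} s lacks)
                      ; idle-f = v′-idle-f
                      ; keeps  = keeps′ }

  exchange : ∀ {ρ f} → Feasible n J ρ → Idle σ f → ¬ Idle ρ f → Exchange ρ f
  exchange {ρ} {f} ρ-feasible σf ρf-busy with jobAt ρ f in ρf
  ... | nothing = contradiction refl ρf-busy
  ... | just j  = augment σf start (<-wellFounded _)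
    where
    v₀ : Schedule n J
    v₀ = assign ρ f nothing

    keeps₀ : Idle ρ ⊆ Idle v₀
    keeps₀ {x} ρx with x ≟ᶠ f
    ... | yes refl = jobAt-assign ρ f nothing
    ... | no x≢f   = trans (jobAt-assign-≢ ρ nothing x≢f) ρx

    start : Augmenting ρ f v₀ j
    start = record
      { within = assign-within {σ = ρ} (feasible⇒within {σ = ρ} ρ-feasible) (λ _ ())
      ; lacks  = subst (λ m → Lacks m v₀) ρf
                       (assign-lacks {σ = ρ} f (feasible⇒lacks {σ = ρ} ρ-feasible))
      ; idle-f = jobAt-assign ρ f nothing
      ; keeps  = keeps₀
      }

module _ {n : ℕ} {J : List Job} {σ : Schedule n J} (σ-feasible : Feasible n J σ)
         {F : Pred (Fin n) 0ℓ} (F? : Decidable F) (F-idle : F ⊆ Idle σ)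
         (B : List (ℕ × ℕ)) (F⊆B : ∀ {x} → F x → InSt B (slot x)) where

  Vacated : Schedule n J → Set
  Vacated ρ = ∃ λ (ρ* : Schedule n J) →
    Feasible n J ρ* × F ⊆ Idle ρ* × agreeCount B ρ ≤ agreeCount B ρ*

  private
    busyOnF : Schedule n J → ℕ
    busyOnF ρ = count (F? ∩? ∁? (idle? ρ)) (allFin n)

    fewer-busy : ∀ {ρ ρ′ : Schedule n J} {f y} → F f → ¬ Idle ρ f → Idle ρ′ f →
                 ¬ Idle σ y → (∀ {x} → x ≢ y → Idle ρ x → Idle ρ′ x) → busyOnF ρ′ < busyOnF ρ
    fewer-busy {ρ} {ρ′} {f} Ff ρf-busy ρ′f σy-busy keeps =
      count-< (F? ∩? ∁? (idle? ρ)) (F? ∩? ∁? (idle? ρ′)) still-busy (Ff , ρf-busy)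
              (λ (_ , ρ′f-busy) → ρ′f-busy ρ′f) (∈-allFin⁺ f)
      where
      still-busy : F ∩ ∁ (Idle ρ′) ⊆ F ∩ ∁ (Idle ρ)
      still-busy (Fx , ρ′x-busy) =
        Fx , λ ρx → ρ′x-busy (keeps (λ x≡y → σy-busy (subst (Idle σ) x≡y (F-idle Fx))) ρx)

    -- The exchange gives up at most the agreement slot y and gains f ∈ F ⊆ st(B).
    agreement-kept : ∀ {ρ ρ′ : Schedule n J} {f y} → F f → ¬ Idle ρ f → Idle ρ′ f →
                     (∀ {x} → x ≢ y → Idle ρ x → Idle ρ′ x) →
                     agreeCount B ρ ≤ agreeCount B ρ′
    agreement-kept {ρ} {ρ′} {f} {y} Ff ρf-busy ρ′f keeps = begin
      agreeCount B ρ
        ≤⟨ count-⊆-∪ (_≟ᶠ y) agreeOff-y? (agreementSlot? B ρ) y-or-off-y (allFin n) ⟩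
      count (_≟ᶠ y) (allFin n) + count agreeOff-y? (allFin n)
        ≤⟨ +-monoˡ-≤ _ (count-≟-allFin y) ⟩
      suc (count agreeOff-y? (allFin n))
        ≤⟨ count-< (agreementSlot? B ρ′) agreeOff-y? kept (F⊆B Ff , ρ′f)
                   (λ ((_ , ρf-idle) , _) → ρf-busy ρf-idle) (∈-allFin⁺ f) ⟩
      agreeCount B ρ′
        ∎
      where
      open ≤-Reasoning

      agreeOff-y? : Decidable (AgreementSlot B ρ ∩ ∁ (_≡ y))
      agreeOff-y? = agreementSlot? B ρ ∩? ∁? (_≟ᶠ y)

      y-or-off-y : AgreementSlot B ρ ⊆ (_≡ y) ∪ (AgreementSlot B ρ ∩ ∁ (_≡ y))
      y-or-off-y {x} agrees with x ≟ᶠ y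
      ... | yes x≡y = inj₁ x≡y
      ... | no x≢y  = inj₂ (agrees , x≢y)

      kept : AgreementSlot B ρ ∩ ∁ (_≡ y) ⊆ AgreementSlot B ρ′
      kept ((inB , ρx) , x≢y) = inB , keeps x≢y ρx

    vacate-acc : (ρ : Schedule n J) → Feasible n J ρ → Acc _<_ (busyOnF ρ) → Vacated ρ
    vacate-acc ρ ρ-feasible (acc more) with any? (F? ∩? ∁? (idle? ρ))
    ... | no none = ρ , ρ-feasible , F-idleρ , ≤-refl
      where
      F-idleρ : F ⊆ Idle ρ
      F-idleρ {x} Fx = decidable-stable (idle? ρ x) (λ busy → none (x , Fx , busy))
    ... | yes (f , Ff , ρf-busy) with exchange {σ = σ} σ-feasible {ρ} {f} ρ-feasible (F-idle Ff) ρf-busy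
    ...   | ρ′ , y , ρ′-feasible , ρ′f , σy-busy , keeps =
      let fewer = fewer-busy {ρ} {ρ′} {f} {y} Ff ρf-busy ρ′f σy-busy keeps
          kept  = agreement-kept {ρ} {ρ′} {f} {y} Ff ρf-busy ρ′f keeps
          ρ* , ρ*-feasible , F-idle* , gain = vacate-acc ρ′ ρ′-feasible (more fewer)
      in  ρ* , ρ*-feasible , F-idle* , ≤-trans kept gain

  vacate : (ρ : Schedule n J) → Feasible n J ρ → Vacated ρ
  vacate ρ ρ-feasible = vacate-acc ρ ρ-feasible (<-wellFounded _)

injectˡ : (xs ys : List X) → Fin (length xs) → Fin (length (xs ++ ys))
injectˡ (_ ∷ xs) ys zero    = zero
injectˡ (_ ∷ xs) ys (suc k) = suc (injectˡ xs ys k)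

injectʳ : (xs ys : List X) → Fin (length ys) → Fin (length (xs ++ ys))
injectʳ []       ys q = q
injectʳ (_ ∷ xs) ys q = suc (injectʳ xs ys q)

split : (xs ys : List X) → Fin (length (xs ++ ys)) → Fin (length xs) ⊎ Fin (length ys)
split []       ys K       = inj₂ K
split (_ ∷ xs) ys zero    = inj₁ zero
split (_ ∷ xs) ys (suc K) = map₁ suc (split xs ys K)

split-injectˡ : (xs ys : List X) (k : Fin (length xs)) → split xs ys (injectˡ xs ys k) ≡ inj₁ k
split-injectˡ (_ ∷ xs) ys zero    = refl
split-injectˡ (_ ∷ xs) ys (suc k) = cong (map₁ suc) (split-injectˡ xs ys k)

split-injectʳ : (xs ys : List X) (q : Fin (length ys)) → split xs ys (injectʳ xs ys q) ≡ inj₂ q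
split-injectʳ []       ys q = refl
split-injectʳ (_ ∷ xs) ys q = cong (map₁ suc) (split-injectʳ xs ys q)

inject-split : (xs ys : List X) (K : Fin (length (xs ++ ys))) →
               [ injectˡ xs ys , injectʳ xs ys ]′ (split xs ys K) ≡ K
inject-split []       ys K       = refl
inject-split (_ ∷ xs) ys zero    = refl
inject-split (_ ∷ xs) ys (suc K) with split xs ys K | inject-split xs ys K
... | inj₁ _ | eq = cong suc eq
... | inj₂ _ | eq = cong suc eq

injectˡ-injective : (xs ys : List X) {k k′ : Fin (length xs)} →
                    injectˡ xs ys k ≡ injectˡ xs ys k′ → k ≡ k′
injectˡ-injective xs ys {k} {k′} eq = inj₁-injective (begin
  inj₁ k                          ≡⟨ split-injectˡ xs ys k ⟨
  split xs ys (injectˡ xs ys k)   ≡⟨ cong (split xs ys) eq ⟩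
  split xs ys (injectˡ xs ys k′)  ≡⟨ split-injectˡ xs ys k′ ⟩
  inj₁ k′                         ∎)
  where open ≡-Reasoning

injectʳ-injective : (xs ys : List X) {q q′ : Fin (length ys)} →
                    injectʳ xs ys q ≡ injectʳ xs ys q′ → q ≡ q′
injectʳ-injective xs ys {q} {q′} eq = inj₂-injective (begin
  inj₂ q                          ≡⟨ split-injectʳ xs ys q ⟨
  split xs ys (injectʳ xs ys q)   ≡⟨ cong (split xs ys) eq ⟩
  split xs ys (injectʳ xs ys q′)  ≡⟨ split-injectʳ xs ys q′ ⟩
  inj₂ q′                         ∎)
  where open ≡-Reasoning

injectˡ≢injectʳ : (xs ys : List X) {k : Fin (length xs)} {q : Fin (length ys)} →
                  injectˡ xs ys k ≢ injectʳ xs ys q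
injectˡ≢injectʳ xs ys {k} {q} eq
  with trans (sym (split-injectˡ xs ys k)) (trans (cong (split xs ys) eq) (split-injectʳ xs ys q))
... | ()

isInj₁-split : (xs ys : List X) {K : Fin (length (xs ++ ys))} {k : Fin (length xs)} →
               isInj₁ (split xs ys K) ≡ just k → K ≡ injectˡ xs ys k
isInj₁-split xs ys {K} is-k with split xs ys K | inject-split xs ys K
... | inj₁ k′ | k′≡K = trans (sym k′≡K) (cong (injectˡ xs ys) (just-injective is-k))

lookup-injectˡ : (xs ys : List X) (k : Fin (length xs)) →
                 lookupₗ (xs ++ ys) (injectˡ xs ys k) ≡ lookupₗ xs k
lookup-injectˡ (_ ∷ xs) ys zero    = refl
lookup-injectˡ (_ ∷ xs) ys (suc k) = lookup-injectˡ xs ys k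

lookup-injectʳ : (xs ys : List X) (q : Fin (length ys)) →
                 lookupₗ (xs ++ ys) (injectʳ xs ys q) ≡ lookupₗ ys q
lookup-injectʳ []       ys q = refl
lookup-injectʳ (_ ∷ xs) ys q = lookup-injectʳ xs ys q

-- Removing and adding the rigid jobs

module _ {n : ℕ} {J R : List Job} where

  restrict : Schedule n (J ++ R) → Schedule n J
  restrict τ = sched (tabulate λ x → jobAt τ x >>= isInj₁ ∘ split J R)

  private
    restrict-jobAt : (τ : Schedule n (J ++ R)) (x : Fin n) →
                     jobAt (restrict τ) x ≡ (jobAt τ x >>= isInj₁ ∘ split J R)
    restrict-jobAt τ = lookup∘tabulate _

    restrict-runs : ∀ {τ : Schedule n (J ++ R)} {x k} →
                    jobAt (restrict τ) x ≡ just k → jobAt τ x ≡ just (injectˡ J R k)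
    restrict-runs {τ} {x} runs = from-bind (jobAt τ x) (trans (sym (restrict-jobAt τ x)) runs)
      where
      from-bind : ∀ {k} m → (m >>= isInj₁ ∘ split J R) ≡ just k → m ≡ just (injectˡ J R k)
      from-bind (just K) is-k = cong just (isInj₁-split J R is-k)

    restrict-runs⁻ : ∀ {τ : Schedule n (J ++ R)} {x k} →
                     jobAt τ x ≡ just (injectˡ J R k) → jobAt (restrict τ) x ≡ just k
    restrict-runs⁻ {τ} {x} {k} runs = begin
      jobAt (restrict τ) x                   ≡⟨ restrict-jobAt τ x ⟩
      (jobAt τ x >>= isInj₁ ∘ split J R)     ≡⟨ cong (_>>= isInj₁ ∘ split J R) runs ⟩
      isInj₁ (split J R (injectˡ J R k))     ≡⟨ cong isInj₁ (split-injectˡ J R k) ⟩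
      just k                                 ∎
      where open ≡-Reasoning

  restrict-idle : ∀ {τ : Schedule n (J ++ R)} {x} → Idle τ x → Idle (restrict τ) x
  restrict-idle {τ} {x} idle = trans (restrict-jobAt τ x) (cong (_>>= isInj₁ ∘ split J R) idle)

  restrict-idle-injectʳ : ∀ {τ : Schedule n (J ++ R)} {x q} →
                          jobAt τ x ≡ just (injectʳ J R q) → Idle (restrict τ) x
  restrict-idle-injectʳ {τ} {x} {q} runs = begin
    jobAt (restrict τ) x                   ≡⟨ restrict-jobAt τ x ⟩
    (jobAt τ x >>= isInj₁ ∘ split J R)     ≡⟨ cong (_>>= isInj₁ ∘ split J R) runs ⟩
    isInj₁ (split J R (injectʳ J R q))     ≡⟨ cong isInj₁ (split-injectʳ J R q) ⟩
    nothing                                ∎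
    where open ≡-Reasoning

  restrict-feasible : {τ : Schedule n (J ++ R)} → Feasible n (J ++ R) τ → Feasible n J (restrict τ)
  restrict-feasible {τ} τ-feasible k = within , counts
    where
    within : ∀ x → jobAt (restrict τ) x ≡ just k → InInterval (lookupₗ J k) (slot x)
    within x runs = subst (λ j → InInterval j (slot x)) (lookup-injectˡ J R k)
                          (proj₁ (τ-feasible (injectˡ J R k)) x (restrict-runs {τ} runs))

    counts : slotsOf (restrict τ) k ≡ p (lookupₗ J k)
    counts = begin
      slotsOf (restrict τ) k
        ≡⟨ slotsOf≡count (restrict τ) k ⟩
      count (λ x → jobAt (restrict τ) x ≟ₘ just k) (allFin n)
        ≡⟨ count-cong _ (λ x → jobAt τ x ≟ₘ just (injectˡ J R k))
                      (restrict-runs {τ}) (restrict-runs⁻ {τ}) (allFin n) ⟩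
      count (λ x → jobAt τ x ≟ₘ just (injectˡ J R k)) (allFin n)
        ≡⟨ slotsOf≡count τ (injectˡ J R k) ⟨
      slotsOf τ (injectˡ J R k)
        ≡⟨ proj₂ (τ-feasible (injectˡ J R k)) ⟩
      p (lookupₗ (J ++ R) (injectˡ J R k))
        ≡⟨ cong p (lookup-injectˡ J R k) ⟩
      p (lookupₗ J k)
        ∎
      where open ≡-Reasoning

module _ {n : ℕ} {J R : List Job} {F : Pred (Fin n) 0ℓ} (cover : RigidCover n F R) where

  private
    Covered : Fin n → Set
    Covered x = ∃ λ q → InInterval (lookupₗ R q) (slot x)

    covered? : (x : Fin n) → Dec (Covered x)
    covered? x = any? λ q → inInterval? (lookupₗ R q) (slot x)

    rigid : ∀ q → ValidJob n (lookupₗ R q) × Rigid (lookupₗ R q)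
    rigid q = All.lookup (proj₁ cover) (∈-lookup q)

    covered⇒F : ∀ {q x} → InInterval (lookupₗ R q) (slot x) → F x
    covered⇒F {q} {x} inside = Equivalence.to (proj₂ (proj₂ cover) x) (lose (∈-lookup q) inside)

    F⇒covered : ∀ {x} → F x → Covered x
    F⇒covered {x} Fx = Any.index covering , lookup-index covering
      where
      covering : Any (λ j → InInterval j (slot x)) R
      covering = Equivalence.from (proj₂ (proj₂ cover) x) Fx

    covering-unique : ∀ {q q′ s} → InInterval (lookupₗ R q) s → InInterval (lookupₗ R q′) s →
                      q ≡ q′
    covering-unique {q} {q′} (r≤s , s≤d) (r′≤s , s≤d′) with q ≟ᶠ q′
    ... | yes q≡q′ = q≡q′
    ... | no q≢q′ with proj₁ (proj₂ cover) q q′ q≢q′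
    ...   | inj₁ d<r′ = contradiction (≤-trans r′≤s s≤d) (<⇒≱ d<r′)
    ...   | inj₂ d′<r = contradiction (≤-trans r≤s s≤d′) (<⇒≱ d′<r)

  rigid-occupies : {τ : Schedule n (J ++ R)} → Feasible n (J ++ R) τ →
                   ∀ {x} → F x → ∃ λ q → jobAt τ x ≡ just (injectʳ J R q)
  rigid-occupies {τ} τ-feasible {x} Fx =
    q , rigid-fills {τ = τ} τ-feasible (subst (ValidJob n) q≡K (proj₁ (rigid q)))
                                       (subst Rigid q≡K (proj₂ (rigid q)))
                                       (subst (λ j → InInterval j (slot x)) q≡K (proj₂ (F⇒covered Fx)))
    where
    q : Fin (length R)
    q = proj₁ (F⇒covered Fx)

    q≡K : lookupₗ R q ≡ lookupₗ (J ++ R) (injectʳ J R q)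
    q≡K = sym (lookup-injectʳ J R q)

  private
    extendAt : ∀ {x} → Maybe (Fin (length J)) → Dec (Covered x) → Maybe (Fin (length (J ++ R)))
    extendAt (just k) _             = just (injectˡ J R k)
    extendAt nothing  (yes (q , _)) = just (injectʳ J R q)
    extendAt nothing  (no _)        = nothing

  extend : Schedule n J → Schedule n (J ++ R)
  extend ρ = sched (tabulate λ x → extendAt (jobAt ρ x) (covered? x))

  private
    extend-jobAt : (ρ : Schedule n J) (x : Fin n) → jobAt (extend ρ) x ≡ extendAt (jobAt ρ x) (covered? x)
    extend-jobAt ρ = lookup∘tabulate _

    extend-jobAt-idle : ∀ {ρ x} → Idle ρ x → jobAt (extend ρ) x ≡ extendAt nothing (covered? x)
    extend-jobAt-idle {ρ} {x} idle = trans (extend-jobAt ρ x) (cong (λ m → extendAt m (covered? x)) idle)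

    extendAt-injectˡ : ∀ {x k} m (c : Dec (Covered x)) → extendAt m c ≡ just (injectˡ J R k) →
                       m ≡ just k
    extendAt-injectˡ (just _) _             runs = cong just (injectˡ-injective J R (just-injective runs))
    extendAt-injectˡ nothing  (yes (q , _)) runs =
      contradiction (sym (just-injective runs)) (injectˡ≢injectʳ J R)

    extendAt-injectʳ : ∀ {x q} m (c : Dec (Covered x)) → extendAt m c ≡ just (injectʳ J R q) →
                       InInterval (lookupₗ R q) (slot x)
    extendAt-injectʳ (just _) _ runs = contradiction (just-injective runs) (injectˡ≢injectʳ J R)
    extendAt-injectʳ {x} nothing (yes (q′ , inside)) runs =
      subst (λ q → InInterval (lookupₗ R q) (slot x)) (injectʳ-injective J R (just-injective runs)) inside

    extend-runsˡ : ∀ {ρ x k} → jobAt (extend ρ) x ≡ just (injectˡ J R k) → jobAt ρ x ≡ just k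
    extend-runsˡ {ρ} {x} runs =
      extendAt-injectˡ (jobAt ρ x) (covered? x) (trans (sym (extend-jobAt ρ x)) runs)

    extend-runsˡ⁻ : ∀ {ρ x k} → jobAt ρ x ≡ just k → jobAt (extend ρ) x ≡ just (injectˡ J R k)
    extend-runsˡ⁻ {ρ} {x} runs = trans (extend-jobAt ρ x) (cong (λ m → extendAt m (covered? x)) runs)

    extend-runsʳ : ∀ {ρ x q} → jobAt (extend ρ) x ≡ just (injectʳ J R q) →
                   InInterval (lookupₗ R q) (slot x)
    extend-runsʳ {ρ} {x} runs =
      extendAt-injectʳ (jobAt ρ x) (covered? x) (trans (sym (extend-jobAt ρ x)) runs)

    extend-runsʳ⁻ : ∀ {ρ x q} → Idle ρ x → InInterval (lookupₗ R q) (slot x) →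
                    jobAt (extend ρ) x ≡ just (injectʳ J R q)
    extend-runsʳ⁻ {ρ} {x} {q} idle inside = trans (extend-jobAt-idle {ρ} idle) (runs-at (covered? x))
      where
      runs-at : (c : Dec (Covered x)) → extendAt nothing c ≡ just (injectʳ J R q)
      runs-at (yes (_ , inside′)) = cong (just ∘ injectʳ J R) (covering-unique inside′ inside)
      runs-at (no uncovered)      = contradiction (q , inside) uncovered

  extend-idle : ∀ {ρ x} → Idle ρ x → ¬ F x → Idle (extend ρ) x
  extend-idle {ρ} {x} idle ¬Fx = trans (extend-jobAt-idle {ρ} idle) (idle-at (covered? x))
    where
    idle-at : (c : Dec (Covered x)) → extendAt nothing c ≡ nothing
    idle-at (yes (_ , inside)) = contradiction (covered⇒F inside) ¬Fx
    idle-at (no _)             = refl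

  extend-feasible : {ρ : Schedule n J} → Feasible n J ρ → F ⊆ Idle ρ → Feasible n (J ++ R) (extend ρ)
  extend-feasible {ρ} ρ-feasible F-idle K with split J R K | inject-split J R K
  ... | inj₁ k | refl = within , counts
    where
    within : ∀ x → jobAt (extend ρ) x ≡ just (injectˡ J R k) →
             InInterval (lookupₗ (J ++ R) (injectˡ J R k)) (slot x)
    within x runs = subst (λ j → InInterval j (slot x)) (sym (lookup-injectˡ J R k))
                          (feasible⇒within {σ = ρ} ρ-feasible k x (extend-runsˡ {ρ} runs))

    counts : slotsOf (extend ρ) (injectˡ J R k) ≡ p (lookupₗ (J ++ R) (injectˡ J R k))
    counts = begin
      slotsOf (extend ρ) (injectˡ J R k)
        ≡⟨ slotsOf≡count (extend ρ) (injectˡ J R k) ⟩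
      count (λ x → jobAt (extend ρ) x ≟ₘ just (injectˡ J R k)) (allFin n)
        ≡⟨ count-cong _ (λ x → jobAt ρ x ≟ₘ just k)
                      (extend-runsˡ {ρ}) (extend-runsˡ⁻ {ρ}) (allFin n) ⟩
      count (λ x → jobAt ρ x ≟ₘ just k) (allFin n)
        ≡⟨ slotsOf≡count ρ k ⟨
      slotsOf ρ k
        ≡⟨ proj₂ (ρ-feasible k) ⟩
      p (lookupₗ J k)
        ≡⟨ cong p (lookup-injectˡ J R k) ⟨
      p (lookupₗ (J ++ R) (injectˡ J R k))
        ∎
      where open ≡-Reasoning
  ... | inj₂ q | refl = within , counts
    where
    within : ∀ x → jobAt (extend ρ) x ≡ just (injectʳ J R q) →
             InInterval (lookupₗ (J ++ R) (injectʳ J R q)) (slot x)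
    within x runs = subst (λ j → InInterval j (slot x)) (sym (lookup-injectʳ J R q)) (extend-runsʳ {ρ} runs)

    counts : slotsOf (extend ρ) (injectʳ J R q) ≡ p (lookupₗ (J ++ R) (injectʳ J R q))
    counts = begin
      slotsOf (extend ρ) (injectʳ J R q)
        ≡⟨ slotsOf≡count (extend ρ) (injectʳ J R q) ⟩
      count (λ x → jobAt (extend ρ) x ≟ₘ just (injectʳ J R q)) (allFin n)
        ≡⟨ count-cong _ (λ x → inInterval? (lookupₗ R q) (slot x)) (extend-runsʳ {ρ})
                      (λ inside → extend-runsʳ⁻ {ρ} (F-idle (covered⇒F inside)) inside) (allFin n) ⟩
      count (λ x → inInterval? (lookupₗ R q) (slot x)) (allFin n)
        ≡⟨ uncurry (rigid-count (lookupₗ R q)) (rigid q) ⟩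
      p (lookupₗ R q)
        ≡⟨ cong p (lookup-injectʳ J R q) ⟨
      p (lookupₗ (J ++ R) (injectʳ J R q))
        ∎
      where open ≡-Reasoning

-- One more event

module _ {n : ℕ} {J R : List Job} (A : List (ℕ × ℕ)) {σ : Schedule n J} (σ-feasible : Feasible n J σ)
         (cover : RigidCover n (AgreementSlot A σ) R) (b : ℕ × ℕ) where

  agr-∷-≤ : agr n J (b ∷ A) ≤ agr n J A + agr n (J ++ R) (b ∷ [])
  agr-∷-≤ with agr-attained (b ∷ A) (σ , σ-feasible)
  ... | τ , τ-feasible , agr≡τ with vacate {σ = σ} σ-feasible (agreementSlot? A σ) proj₂ (b ∷ A)
                                            (thereₗ ∘ proj₁) τ τ-feasible
  ...   | ρ , ρ-feasible , F-idle , gain = begin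
    agr n J (b ∷ A)
      ≡⟨ agr≡τ ⟩
    agreeCount (b ∷ A) τ
      ≤⟨ gain ⟩
    agreeCount (b ∷ A) ρ
      ≤⟨ count-⊆-∪ (agreementSlot? A ρ) (agreementSlot? (b ∷ []) ρ⁺) (agreementSlot? (b ∷ A) ρ)
                   in-A-or-b (allFin n) ⟩
    agreeCount A ρ + agreeCount (b ∷ []) ρ⁺
      ≤⟨ +-mono-≤ (agreeCount≤agr A {ρ} ρ-feasible) (agreeCount≤agr (b ∷ []) {ρ⁺} ρ⁺-feasible) ⟩
    agr n J A + agr n (J ++ R) (b ∷ [])
      ∎
    where
    open ≤-Reasoning

    ρ⁺ : Schedule n (J ++ R)
    ρ⁺ = extend cover ρ

    ρ⁺-feasible : Feasible n (J ++ R) ρ⁺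
    ρ⁺-feasible = extend-feasible cover {ρ} ρ-feasible F-idle

    in-A-or-b : AgreementSlot (b ∷ A) ρ ⊆ AgreementSlot A ρ ∪ AgreementSlot (b ∷ []) ρ⁺
    in-A-or-b (thereₗ in-A , idle) = inj₁ (in-A , idle)
    in-A-or-b {x} (hereₗ in-b , idle) with inSt? A (slot x)
    ... | yes in-A = inj₁ (in-A , idle)
    ... | no ∉A    = inj₂ (hereₗ in-b , extend-idle cover {ρ} idle (∉A ∘ proj₁))

  agr-∷-≥ : agreeCount A σ ≡ agr n J A → agr n J A + agr n (J ++ R) (b ∷ []) ≤ agr n J (b ∷ A)
  agr-∷-≥ σ-optimal
    with agr-attained (b ∷ []) (extend cover σ , extend-feasible cover {σ} σ-feasible proj₂)
  ... | τ , τ-feasible , agr≡τ = begin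
    agr n J A + agr n (J ++ R) (b ∷ [])
      ≡⟨ cong₂ _+_ (sym σ-optimal) agr≡τ ⟩
    agreeCount A σ + agreeCount (b ∷ []) τ
      ≤⟨ count-disjoint-⊆ (agreementSlot? A σ) (agreementSlot? (b ∷ []) τ) (agreementSlot? (b ∷ A) τ∣J)
                          disjoint merged (allFin n) ⟩
    agreeCount (b ∷ A) τ∣J
      ≤⟨ agreeCount≤agr (b ∷ A) {τ∣J} (restrict-feasible {J = J} {R} {τ} τ-feasible) ⟩
    agr n J (b ∷ A)
      ∎
    where
    open ≤-Reasoning

    τ∣J : Schedule n J
    τ∣J = restrict {J = J} {R} τ

    rigid-on-F : ∀ {x} → AgreementSlot A σ x → ∃ λ q → jobAt τ x ≡ just (injectʳ J R q)
    rigid-on-F = rigid-occupies {J = J} cover {τ} τ-feasible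

    disjoint : AgreementSlot A σ ⊥ AgreementSlot (b ∷ []) τ
    disjoint (F-x , _ , τx-idle) with trans (sym τx-idle) (proj₂ (rigid-on-F F-x))
    ... | ()

    merged : AgreementSlot A σ ∪ AgreementSlot (b ∷ []) τ ⊆ AgreementSlot (b ∷ A) τ∣J
    merged (inj₁ F-x)                 =
      thereₗ (proj₁ F-x) , restrict-idle-injectʳ {J = J} {R} {τ} (proj₂ (rigid-on-F F-x))
    merged (inj₂ (hereₗ in-b , idle)) = hereₗ in-b , restrict-idle {J = J} {R} {τ} idle

  agr-∷ : agreeCount A σ ≡ agr n J A → agr n J (b ∷ A) ≡ agr n J A + agr n (J ++ R) (b ∷ [])
  agr-∷ σ-optimal = ≤-antisym agr-∷-≤ (agr-∷-≥ σ-optimal)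

sumFin-cong : ∀ a {f g : Fin a → ℕ} → (∀ i → f i ≡ g i) → sumFin a f ≡ sumFin a g
sumFin-cong zero    f≗g = refl
sumFin-cong (suc a) f≗g = cong₂ _+_ (f≗g zero) (sumFin-cong a (f≗g ∘ suc))

sumFin-distrib-+ : ∀ a (f g : Fin a → ℕ) → sumFin a (λ i → f i + g i) ≡ sumFin a f + sumFin a g
sumFin-distrib-+ zero    f g = refl
sumFin-distrib-+ (suc a) f g =
  trans (cong (f zero + g zero +_) (sumFin-distrib-+ a (f ∘ suc) (g ∘ suc)))
        (interchange (f zero) (g zero) (sumFin a (f ∘ suc)) (sumFin a (g ∘ suc)))

-- Not needed: 0 < α₂, that S is a partial event schedule with e* ∉ S (agr-∷ holds for any
-- list of blocks), and the feasibility of the J i, which σ witnesses anyway.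
lemma7 : (α₁ α₂ : ℕ) → 0 < α₂ → α₂ ≤ α₁ →
    (oneEvent : OneEventAlg) → IsApprox α₁ α₂ oneEvent →
    (n a : ℕ) (J : Fin a → List Job) →
    (∀ i → All (ValidJob n) (J i)) → (∀ i → JobSetFeasible n (J i)) →
    (k : ℕ) (len : Fin k → ℕ) → (∀ e → len e ≤ n) →
    (S : List (Fin k × ℕ)) → PartialEventSchedule n len S →
    (e* : Fin k) → e* ∉ map proj₁ S →
    (σ : (i : Fin a) → Schedule n (J i)) →
    (∀ i → Feasible n (J i) (σ i)) →
    (∀ i → agreeCount (blocks len S) (σ i) ≡ agr n (J i) (blocks len S)) →
    (R : Fin a → List Job) →
    (∀ i → RigidCover n (AgreementSlot (blocks len S) (σ i)) (R i)) →
    ∀ t → ValidStart n (len e*) t →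
      α₂ * sumFin a (λ i → agr n (J i) (blocks len ((e* , t) ∷ S)))
        ≤ α₁ * sumFin a (λ i → agr n (J i)
                 (blocks len ((e* , oneEvent n a (λ i → J i ++ R i) (len e*)) ∷ S)))
lemma7 α₁ α₂ _ α₂≤α₁ oneEvent approx n a J J-valid _ k len len≤n S _ e* _
       σ σ-feasible σ-optimal R cover t t-valid = begin
  α₂ * sumFin a (λ i → agr n (J i) ((l , t) ∷ A))      ≡⟨ cong (α₂ *_) (split-sum t) ⟩
  α₂ * (sumFin a agr-S + sumFin a (agr-e* t))            ≡⟨ *-distribˡ-+ α₂ _ _ ⟩
  α₂ * sumFin a agr-S + α₂ * sumFin a (agr-e* t)        ≤⟨ +-mono-≤ (*-monoˡ-≤ _ α₂≤α₁)
                                                                    (proj₂ one-event t t-valid) ⟩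
  α₁ * sumFin a agr-S + α₁ * sumFin a (agr-e* t*)       ≡⟨ *-distribˡ-+ α₁ _ _ ⟨
  α₁ * (sumFin a agr-S + sumFin a (agr-e* t*))           ≡⟨ cong (α₁ *_) (split-sum t*) ⟨
  α₁ * sumFin a (λ i → agr n (J i) ((l , t*) ∷ A))     ∎
  where
  open ≤-Reasoning

  l : ℕ
  l = len e*

  A : List (ℕ × ℕ)
  A = blocks len S

  J′ : Fin a → List Job
  J′ i = J i ++ R i

  t* : ℕ
  t* = oneEvent n a J′ l

  agr-S : Fin a → ℕ
  agr-S i = agr n (J i) A

  agr-e* : ℕ → Fin a → ℕ
  agr-e* u i = agr n (J′ i) ((l , u) ∷ [])

  split-sum : ∀ u → sumFin a (λ i → agr n (J i) ((l , u) ∷ A)) ≡ sumFin a agr-S + sumFin a (agr-e* u)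
  split-sum u = trans (sumFin-cong a λ i → agr-∷ A {σ i} (σ-feasible i) (cover i) (l , u) (σ-optimal i))
                      (sumFin-distrib-+ a agr-S (agr-e* u))

  one-event : ValidStart n l t* ×
              (∀ u → ValidStart n l u → α₂ * sumFin a (agr-e* u) ≤ α₁ * sumFin a (agr-e* t*))
  one-event = approx n a J′ l (λ i → ++⁺ (J-valid i) (All.map proj₁ (proj₁ (cover i))))
                     (λ i → extend (cover i) (σ i) , extend-feasible (cover i) {σ i} (σ-feasible i) proj₂)
                     (len≤n e*)
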